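{- Let $X$ be a finite set, let $M$ be a set, let $\mathcal T=(T,t)$ be a discriminating labelled rooted tree on $X$, and let $Y\subseteq X$ with $|Y|\geq 4$ be such that the restriction $\delta_{\mathcal T}|_Y$ of $\delta_{\mathcal T}$ to $\binom{Y}{3}$ has a unique discriminating representation $\mathcal T_Y=(T_Y,t_Y)$. If a triplet $r$ is displayed by $T_Y$, then $r$ is displayed by $T$.
   Context: A rooted phylogenetic tree on a set $Z$ is a rooted tree with leaf set $Z$ having no vertex of indegree one and outdegree one; a labelled rooted tree is a pair $(T,t)$ with $t$ a map from internal vertices to $M$; it is discriminating if adjacent internal vertices have distinct labels. $\mathrm{lca}_T(x,y)$ is the last common vertex of the root-to-$x$ and root-to-$y$ paths. $\delta_{\mathcal T}(x,y,z)$ is the multiset $\{t(\mathrm{lca}_T(x,y)),t(\mathrm{lca}_T(x,z)),t(\mathrm{lca}_T(y,z))\}$. A labelled rooted tree $(T',t')$ on $Y$ represents a map $\delta':\binom{Y}{3}\to$ (multisets) if $\delta'(x,y,z)=\{t'(\mathrm{lca}_{T'}(x,y)),t'(\mathrm{lca}_{T'}(x,z)),t'(\mathrm{lca}_{T'}(y,z))\}$ for all distinct $x,y,z\in Y$; uniqueness is up to isomorphism of labelled trees fixing $Y$. A triplet $xy|z$ is displayed by a rooted tree $T$ if $\mathrm{lca}_T(x,z)=\mathrm{lca}_T(y,z)\neq\mathrm{lca}_T(x,y)$. -}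

module Defs where

open import Data.Nat using (ℕ; zero; suc; _≤_)
open import Data.Fin using (Fin; _≟_)
open import Data.Fin.Subset using (Subset; _∈_)
open import Data.List using (List; []; _∷_; _++_; length)
open import Data.List.Membership.Propositional using () renaming (_∈_ to _∈ₗ_)
open import Data.List.Relation.Unary.Unique.Propositional using (Unique)
open import Data.List.Relation.Binary.Permutation.Propositional using (_↭_)
open import Data.Maybe using (Maybe; just; nothing; _>>=_; Is-just)
open import Data.Product using (_×_; Σ; _,_)
open import Relation.Binary.PropositionalEquality using (_≡_; _≢_)
open import Relation.Nullary using (yes; no; ¬_)

-- Rooted trees whose leaves carry elements of Fin n (the finite set X)
-- and whose internal vertices carry labels in M.  A tree is identified
-- with its root; children are listed in some order (order is irrelevant,
-- see _≅_ below).
data Tree (n : ℕ) (M : Set) : Set where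
  leaf : Fin n → Tree n M
  node : M → List (Tree n M) → Tree n M

module _ {n : ℕ} {M : Set} where

  mutual
    leaves : Tree n M → List (Fin n)
    leaves (leaf x) = x ∷ []
    leaves (node _ ts) = leavesL ts

    leavesL : List (Tree n M) → List (Fin n)
    leavesL [] = []
    leavesL (t ∷ ts) = leaves t ++ leavesL ts

  mutual
    data NoUnary : Tree n M → Set where
      leafN : ∀ x → NoUnary (leaf x)
      nodeN : ∀ m ts → 2 ≤ length ts → AllNoUnary ts → NoUnary (node m ts)

    data AllNoUnary : List (Tree n M) → Set where
      []  : AllNoUnary []
      _∷_ : ∀ {t ts} → NoUnary t → AllNoUnary ts → AllNoUnary (t ∷ ts)

  record IsPhyloOn (Z : Subset n) (T : Tree n M) : Set where
    field
      noUnary   : NoUnary T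
      leavesUnique : Unique (leaves T)
      leafSet   : ∀ x → (x ∈ Z → x ∈ₗ leaves T) × (x ∈ₗ leaves T → x ∈ Z)

  rootLabel : Tree n M → Maybe M
  rootLabel (leaf _) = nothing
  rootLabel (node m _) = just m

  mutual
    data Discriminating : Tree n M → Set where
      leafD : ∀ x → Discriminating (leaf x)
      nodeD : ∀ m ts → ChildrenD m ts → Discriminating (node m ts)

    data ChildrenD (m : M) : List (Tree n M) → Set where
      []  : ChildrenD m []
      _∷_ : ∀ {t ts} → (rootLabel t ≢ just m) × Discriminating t →
            ChildrenD m ts → ChildrenD m (t ∷ ts)

  -- vertices are addressed by paths from the root (lists of child indices)
  mutual
    subtreeAt : Tree n M → List ℕ → Maybe (Tree n M)
    subtreeAt t [] = just t
    subtreeAt (leaf _) (_ ∷ _) = nothing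
    subtreeAt (node _ ts) (i ∷ p) = subtreeAtL ts i p

    subtreeAtL : List (Tree n M) → ℕ → List ℕ → Maybe (Tree n M)
    subtreeAtL [] _ _ = nothing
    subtreeAtL (t ∷ ts) zero p = subtreeAt t p
    subtreeAtL (t ∷ ts) (suc i) p = subtreeAtL ts i p

  -- address of (the first occurrence of) the leaf x, if any
  mutual
    pos : Tree n M → Fin n → Maybe (List ℕ)
    pos (leaf y) x with x ≟ y
    ... | yes _ = just []
    ... | no _ = nothing
    pos (node _ ts) x = posL 0 ts x

    posL : ℕ → List (Tree n M) → Fin n → Maybe (List ℕ)
    posL i [] x = nothing
    posL i (t ∷ ts) x with pos t x
    ... | just p = just (i ∷ p)
    ... | nothing = posL (suc i) ts x

  -- longest common prefix: the address of the last common vertex of two root paths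
  lcp : List ℕ → List ℕ → List ℕ
  lcp (a ∷ as) (b ∷ bs) with Data.Nat._≟_ a b
  ... | yes _ = a ∷ lcp as bs
  ... | no _ = []
  lcp _ _ = []

  lca : Tree n M → Fin n → Fin n → Maybe (List ℕ)
  lca T x y = pos T x >>= λ p → pos T y >>= λ q → just (lcp p q)

  lcaLabel : Tree n M → Fin n → Fin n → Maybe M
  lcaLabel T x y = lca T x y >>= λ v → subtreeAt T v >>= rootLabel

  -- δ_T(x,y,z) as a list, to be compared as a multiset via _↭_
  δ : Tree n M → Fin n → Fin n → Fin n → List (Maybe M)
  δ T x y z = lcaLabel T x y ∷ lcaLabel T x z ∷ lcaLabel T y z ∷ []

  Distinct3 : Fin n → Fin n → Fin n → Set
  Distinct3 x y z = (x ≢ y) × (x ≢ z) × (y ≢ z)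

  Represents : Subset n → Tree n M → Tree n M → Set
  Represents Y T' T = ∀ x y z → x ∈ Y → y ∈ Y → z ∈ Y → Distinct3 x y z →
                      δ T' x y z ↭ δ T x y z

  Displays : Tree n M → Fin n → Fin n → Fin n → Set
  Displays T x y z =
    Is-just (pos T x) × Is-just (pos T y) × Is-just (pos T z) ×
    (lca T x z ≡ lca T y z) × (lca T x y ≢ lca T x z)

  -- isomorphism of labelled rooted trees fixing the leaf labels:
  -- same root label and children matched bijectively up to isomorphism
  mutual
    data _≅_ : Tree n M → Tree n M → Set where
      leaf≅ : ∀ x → leaf x ≅ leaf x
      node≅ : ∀ m {ts ss} → ts ≅L ss → node m ts ≅ node m ss

    data _≅L_ : List (Tree n M) → List (Tree n M) → Set where
      []  : [] ≅L []
      cons : ∀ {t s ts} as bs → t ≅ s → ts ≅L (as ++ bs) →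
             (t ∷ ts) ≅L (as ++ s ∷ bs)

-- T_Y is recovered from T: restrict T to Y (delete the leaves outside Y and suppress the
-- vertices left with one child), then contract every edge whose two ends carry the same label.
-- Both steps keep the label of lca(a, b) for all a, b ∈ Y, and the result is discriminating, so it
-- represents δ_T restricted to Y and by uniqueness is isomorphic to T_Y.  A displayed triplet xy|z
-- is a cluster containing x and y but not z; every cluster of the contracted tree is a cluster of
-- T|Y, which is the trace on Y of a cluster of T, so T displays xy|z as well.
-- Equality of labels is not decidable, but the contraction compares only finitely many of them;
-- since Displays is decidable, it suffices to build the contraction under double negation.

module Submission where

open import Defs
open import Data.Bool using (if_then_else_)
open import Data.Empty using (⊥-elim)
open import Data.Fin using (Fin; toℕ) renaming (_≟_ to _≟ᶠ_)
open import Data.Fin.Properties using (toℕ-injective)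
open import Data.Fin.Subset using (Subset; ⊤; ∣_∣) renaming (_∈_ to _∈ˢ_; _∉_ to _∉ˢ_)
open import Data.Fin.Subset.Properties using (∈⊤) renaming (_∈?_ to _∈ˢ?_)
open import Data.List using (List; []; _∷_; _++_; length; filter)
open import Data.List.Properties using (++-assoc; ++-identityʳ; filter-++; filter-accept; length-++)
import Data.List.Properties as ListP
open import Data.List.Membership.Propositional using (_∈_; _∉_; find; lose)
open import Data.List.Membership.Propositional.Properties
  using (∈-++⁺ˡ; ∈-++⁺ʳ; ∈-++⁻; ∈-∃++; ∈-filter⁺; ∈-filter⁻)
open import Data.List.Membership.Setoid.Properties using (index-injective)
open import Data.List.Relation.Binary.Disjoint.Propositional using (Disjoint)
open import Data.List.Relation.Binary.Permutation.Propositional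
  using (_↭_; ↭-refl; ↭-sym; ↭-reflexive; module PermutationReasoning)
import Data.List.Relation.Binary.Permutation.Propositional.Properties as ↭
open ↭ using (∈-resp-↭)
open import Data.List.Relation.Binary.Pointwise using (Pointwise-≡⇒≡)
open import Data.List.Relation.Binary.Prefix.Heterogeneous using (Prefix; []; _∷_)
import Data.List.Relation.Binary.Prefix.Heterogeneous.Properties as Prefix
open import Data.List.Relation.Binary.Subset.Propositional using (_⊆_)
open import Data.List.Relation.Unary.All as All using (All; []; _∷_)
import Data.List.Relation.Unary.All.Properties as AllP
open import Data.List.Relation.Unary.AllPairs using ([]; _∷_)
open import Data.List.Relation.Unary.Any as Any using (Any; here; there)
import Data.List.Relation.Unary.Any.Properties as AnyP
open import Data.List.Relation.Unary.Unique.Propositional using (Unique)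
import Data.List.Relation.Unary.Unique.Propositional.Properties as UniqueP
open import Data.Maybe using (Maybe; just; nothing; Is-just) renaming (_>>=_ to _>>=ᵐ_)
open import Data.Maybe.Properties using (just-injective; ≡-dec)
import Data.Maybe.Relation.Unary.Any as Maybe
open import Data.Nat using (ℕ; zero; suc; _+_; _≟_; _≤_; s≤s; z≤n)
open import Data.Nat.Properties using (+-identityʳ; +-suc; ≤-trans; m≤n+m)
open import Data.Product using (_×_; _,_; -,_; ∃; ∃₂; ∃-syntax; proj₁; proj₂; uncurry)
import Data.Product as Product
open import Data.Sum using (_⊎_; inj₁; inj₂)
open import Data.Unit using (tt)
open import Effect.Monad using (RawMonad)
open import Function using (_∘_; case_of_)
open import Level using (0ℓ)
open import Relation.Binary.PropositionalEquality
  using (_≡_; _≢_; refl; sym; trans; cong; cong₂; subst; setoid; module ≡-Reasoning)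
open import Relation.Nullary using (Dec; yes; no; ¬_; does)
open import Relation.Nullary.Decidable
  using (_×-dec_; ¬?; decidable-stable; dec-true; dec-false; ¬¬-excluded-middle)
open import Relation.Nullary.Negation using (¬¬-Monad; ¬¬-map)

Unique-++⁻ : {A : Set} (xs : List A) {ys : List A} →
             Unique (xs ++ ys) → Unique xs × Unique ys × Disjoint xs ys
Unique-++⁻ [] u = [] , u , λ ()
Unique-++⁻ (x ∷ xs) (x∉ ∷ u) with Unique-++⁻ xs u
... | uxs , uys , disj = AllP.++⁻ˡ xs x∉ ∷ uxs , uys , λ where
  (here refl , v∈ys) → All.lookup (AllP.++⁻ʳ xs x∉) v∈ys refl
  (there v∈xs , v∈ys) → disj (v∈xs , v∈ys)

Is-just⇒just : {A : Set} {m : Maybe A} → Is-just m → ∃ λ a → m ≡ just a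
Is-just⇒just (Maybe.just _) = _ , refl

infix 4 _≼_
_≼_ : List ℕ → List ℕ → Set
_≼_ = Prefix _≡_

module _ {n : ℕ} {M : Set} where

  leavesL-++ : (as bs : List (Tree n M)) → leavesL (as ++ bs) ≡ leavesL as ++ leavesL bs
  leavesL-++ [] bs = refl
  leavesL-++ (t ∷ as) bs rewrite leavesL-++ as bs = sym (++-assoc (leaves t) (leavesL as) (leavesL bs))

  leaves⊆leavesL : ∀ {c ts} → c ∈ ts → leaves c ⊆ leavesL {n} {M} ts
  leaves⊆leavesL {ts = t ∷ ts} (here refl) = ∈-++⁺ˡ
  leaves⊆leavesL {ts = t ∷ ts} (there c∈) = ∈-++⁺ʳ (leaves t) ∘ leaves⊆leavesL c∈

  childIndex : {c : Tree n M} {ts : List (Tree n M)} → c ∈ ts → ℕ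
  childIndex = toℕ ∘ Any.index

  childIndex-injective : ∀ {c d ts} (c∈ : c ∈ ts) (d∈ : d ∈ ts) → childIndex c∈ ≡ childIndex d∈ → c ≡ d
  childIndex-injective c∈ d∈ = index-injective (setoid (Tree n M)) c∈ d∈ ∘ toℕ-injective

  subtreeAt-child : ∀ m {c ts} (c∈ : c ∈ ts) v → subtreeAt (node m ts) (childIndex c∈ ∷ v) ≡ subtreeAt c v
  subtreeAt-child m (here refl) v = refl
  subtreeAt-child m (there c∈) v = subtreeAt-child m c∈ v

  subtreeAt-node⁻ : ∀ m ts i v {s} → subtreeAt (node m ts) (i ∷ v) ≡ just s →
                    ∃₂ λ c (c∈ : c ∈ ts) → childIndex c∈ ≡ i × subtreeAt c v ≡ just s
  subtreeAt-node⁻ m (t ∷ ts) zero v e = t , here refl , refl , e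
  subtreeAt-node⁻ m (t ∷ ts) (suc i) v e with subtreeAt-node⁻ m ts i v e
  ... | c , c∈ , refl , e′ = c , there c∈ , refl , e′

  mutual
    pos-sound : ∀ t {x p} → pos {n} {M} t x ≡ just p → x ∈ leaves t
    pos-sound (leaf y) {x} e with x ≟ᶠ y
    ... | yes x≡y = here x≡y
    pos-sound (node m ts) e = posL-sound 0 ts e

    posL-sound : ∀ k ts {x p} → posL k ts x ≡ just p → x ∈ leavesL ts
    posL-sound k (t ∷ ts) {x} e with pos t x in e′
    ... | just _ = ∈-++⁺ˡ (pos-sound t e′)
    ... | nothing = ∈-++⁺ʳ (leaves t) (posL-sound (suc k) ts e)

  mutual
    pos-complete : ∀ t {x} → x ∈ leaves t → ∃ λ p → pos {n} {M} t x ≡ just p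
    pos-complete (leaf y) {x} (here x≡y) with x ≟ᶠ y
    ... | yes _ = [] , refl
    ... | no x≢y = ⊥-elim (x≢y x≡y)
    pos-complete (node m ts) x∈ = posL-complete 0 ts x∈

    posL-complete : ∀ k ts {x} → x ∈ leavesL ts → ∃ λ p → posL k ts x ≡ just p
    posL-complete k (t ∷ ts) {x} x∈ with pos t x in e
    ... | just p = k ∷ p , refl
    ... | nothing with ∈-++⁻ (leaves t) x∈
    ...   | inj₁ x∈t = case trans (sym e) (proj₂ (pos-complete t x∈t)) of λ ()
    ...   | inj₂ x∈ts = posL-complete (suc k) ts x∈ts

  pos-∉ : ∀ t {x} → x ∉ leaves t → pos {n} {M} t x ≡ nothing
  pos-∉ t {x} x∉ with pos t x in e
  ... | nothing = refl
  ... | just _ = ⊥-elim (x∉ (pos-sound t e))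

  posL⁻ : ∀ k ts {x r} → posL k ts x ≡ just r →
          ∃₂ λ c (c∈ : c ∈ ts) → ∃ λ p → r ≡ (childIndex c∈ + k) ∷ p × pos c x ≡ just p
  posL⁻ k (t ∷ ts) {x} e with pos t x in e′
  posL⁻ k (t ∷ ts) refl | just p = t , here refl , p , refl , e′
  ... | nothing with posL⁻ (suc k) ts e
  ...   | c , c∈ , p , refl , e″ = c , there c∈ , p , cong (_∷ p) (+-suc (childIndex c∈) k) , e″

  pos-node⁻ : ∀ m ts {x r} → pos (node m ts) x ≡ just r →
              ∃₂ λ c (c∈ : c ∈ ts) → ∃ λ p → r ≡ childIndex c∈ ∷ p × pos c x ≡ just p
  pos-node⁻ m ts e with posL⁻ 0 ts e
  ... | c , c∈ , p , refl , e′ = c , c∈ , p , cong (_∷ p) (+-identityʳ (childIndex c∈)) , e′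

  posL⁺ : ∀ k {ts c x p} (c∈ : c ∈ ts) → Unique (leavesL ts) → x ∈ leaves c → pos c x ≡ just p →
          posL k ts x ≡ just ((childIndex c∈ + k) ∷ p)
  posL⁺ k (here refl) u x∈ e rewrite e = refl
  posL⁺ k {t ∷ ts} (there c∈) u x∈ e
    with Unique-++⁻ (leaves t) u
  ... | _ , uts , disj
    rewrite pos-∉ t (λ x∈t → disj (x∈t , leaves⊆leavesL c∈ x∈))
          | posL⁺ (suc k) c∈ uts x∈ e
          | +-suc (childIndex c∈) k = refl

  pos-node⁺ : ∀ m {ts c x p} (c∈ : c ∈ ts) → Unique (leavesL ts) → pos c x ≡ just p →
              pos (node m ts) x ≡ just (childIndex c∈ ∷ p)
  pos-node⁺ m {c = c} c∈ u e =
    trans (posL⁺ 0 c∈ u (pos-sound c e) e) (cong (λ i → just (i ∷ _)) (+-identityʳ (childIndex c∈)))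

  unique-child : ∀ {c ts} → c ∈ ts → Unique (leavesL ts) → Unique (leaves {n} {M} c)
  unique-child {c} c∈ u with ∈-∃++ c∈
  ... | pre , post , refl with Unique-++⁻ (leavesL pre) (subst Unique (leavesL-++ pre (c ∷ post)) u)
  ...   | _ , u′ , _ = proj₁ (Unique-++⁻ (leaves c) u′)

  All⇒AllNoUnary : ∀ {ts : List (Tree n M)} → All NoUnary ts → AllNoUnary ts
  All⇒AllNoUnary [] = []
  All⇒AllNoUnary (nu ∷ nus) = nu ∷ All⇒AllNoUnary nus

  AllNoUnary⇒All : ∀ {ts : List (Tree n M)} → AllNoUnary ts → All NoUnary ts
  AllNoUnary⇒All [] = []
  AllNoUnary⇒All (nu ∷ nus) = nu ∷ AllNoUnary⇒All nus

  ChildrenD-++ : ∀ {m} {cs ds : List (Tree n M)} → ChildrenD m cs → ChildrenD m ds → ChildrenD m (cs ++ ds)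
  ChildrenD-++ [] dds = dds
  ChildrenD-++ (dc ∷ dcs) dds = dc ∷ ChildrenD-++ dcs dds

  infix 4 _⊑_
  data _⊑_ (s : Tree n M) : Tree n M → Set where
    here  : s ⊑ s
    child : ∀ {m ts c} → c ∈ ts → s ⊑ c → s ⊑ node m ts

  ⊑-child : ∀ {s m ts} → Any (s ⊑_) ts → s ⊑ node m ts
  ⊑-child s⊑ with find s⊑
  ... | c , c∈ , s⊑c = child c∈ s⊑c

  subtreeAt⇒⊑ : ∀ t v {s} → subtreeAt t v ≡ just s → s ⊑ t
  subtreeAt⇒⊑ t [] refl = here
  subtreeAt⇒⊑ (node m ts) (i ∷ v) e with subtreeAt-node⁻ m ts i v e
  ... | c , c∈ , _ , e′ = child c∈ (subtreeAt⇒⊑ c v e′)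

  ⊑⇒subtreeAt : ∀ {s t} → s ⊑ t → ∃ λ v → subtreeAt t v ≡ just s
  ⊑⇒subtreeAt here = [] , refl
  ⊑⇒subtreeAt (child {m} c∈ s⊑c) with ⊑⇒subtreeAt s⊑c
  ... | v , e = childIndex c∈ ∷ v , trans (subtreeAt-child m c∈ v) e

  pos-below : ∀ t v {x p} → pos t x ≡ just p → v ≼ p → ∃ λ s → subtreeAt t v ≡ just s × x ∈ leaves s
  pos-below t [] e [] = t , refl , pos-sound t e
  pos-below (leaf y) (i ∷ v) {x} e (refl ∷ _) with x ≟ᶠ y
  pos-below (leaf y) (i ∷ v) () (refl ∷ _) | yes _
  pos-below (leaf y) (i ∷ v) () (refl ∷ _) | no _
  pos-below (node m ts) (i ∷ v) e (refl ∷ v≼p) with pos-node⁻ m ts e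
  ... | c , c∈ , p , refl , e′ with pos-below c v e′ v≼p
  ...   | s , es , x∈s = s , trans (subtreeAt-child m c∈ v) es , x∈s

  pos-under : ∀ t v {s x} → Unique (leaves t) → subtreeAt t v ≡ just s → x ∈ leaves s →
              ∃ λ p → pos t x ≡ just p × v ≼ p
  pos-under t [] u refl x∈s with pos-complete t x∈s
  ... | p , e = p , e , []
  pos-under (node m ts) (i ∷ v) u e x∈s with subtreeAt-node⁻ m ts i v e
  ... | c , c∈ , refl , e′ with pos-under c v (unique-child c∈ u) e′ x∈s
  ...   | p , ep , v≼p = childIndex c∈ ∷ p , pos-node⁺ m c∈ u ep , refl ∷ v≼p

  private
    lcp′ : List ℕ → List ℕ → List ℕ
    lcp′ = lcp {n} {M}

  lcp-∷ : ∀ a p q → lcp′ (a ∷ p) (a ∷ q) ≡ a ∷ lcp′ p q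
  lcp-∷ a p q with a ≟ a
  ... | yes _ = refl
  ... | no a≢a = ⊥-elim (a≢a refl)

  lcp-≼ˡ : ∀ p q → lcp′ p q ≼ p
  lcp-≼ˡ [] q = []
  lcp-≼ˡ (a ∷ p) [] = []
  lcp-≼ˡ (a ∷ p) (b ∷ q) with a ≟ b
  ... | yes _ = refl ∷ lcp-≼ˡ p q
  ... | no _ = []

  lcp-≼ʳ : ∀ p q → lcp′ p q ≼ q
  lcp-≼ʳ [] q = []
  lcp-≼ʳ (a ∷ p) [] = []
  lcp-≼ʳ (a ∷ p) (b ∷ q) with a ≟ b
  ... | yes refl = refl ∷ lcp-≼ʳ p q
  ... | no _ = []

  lcp-greatest : ∀ {v p q} → v ≼ p → v ≼ q → v ≼ lcp′ p q
  lcp-greatest [] _ = []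
  lcp-greatest {a ∷ v} {a ∷ p} {a ∷ q} (refl ∷ v≼p) (refl ∷ v≼q) =
    subst (a ∷ v ≼_) (sym (lcp-∷ a p q)) (refl ∷ lcp-greatest v≼p v≼q)

  lcp-outside : ∀ {v p} q → v ≼ p → ¬ v ≼ q → lcp′ p q ≡ lcp′ v q
  lcp-outside q [] v⋠q = ⊥-elim (v⋠q [])
  lcp-outside [] (refl ∷ v≼p) v⋠q = refl
  lcp-outside {a ∷ v} {a ∷ p} (b ∷ q) (refl ∷ v≼p) v⋠q with a ≟ b
  ... | yes refl = cong (a ∷_) (lcp-outside q v≼p (v⋠q ∘ (refl ∷_)))
  ... | no _ = refl

  lcp-≼-antisym : ∀ {p q} → p ≼ q → q ≼ p → p ≡ q
  lcp-≼-antisym p≼q q≼p = Pointwise-≡⇒≡ (Prefix.antisym (λ e _ → e) p≼q q≼p)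

  lcp-converge : ∀ px py pz → lcp′ px pz ≡ lcp′ py pz → lcp′ px py ≼ pz → lcp′ px py ≡ lcp′ px pz
  lcp-converge px py pz xz≡yz xy≼pz = lcp-≼-antisym
    (lcp-greatest (lcp-≼ˡ px py) xy≼pz)
    (lcp-greatest (lcp-≼ˡ px pz) (subst (_≼ py) (sym xz≡yz) (lcp-≼ˡ py pz)))

  lcp-split : ∀ {v px py} pz → v ≼ px → v ≼ py → ¬ v ≼ pz → lcp′ px pz ≡ lcp′ py pz × lcp′ px py ≢ lcp′ px pz
  lcp-split {v} pz v≼px v≼py v⋠pz =
    trans xz≡vz (sym (lcp-outside pz v≼py v⋠pz)) ,
    λ xy≡xz → v⋠pz (Prefix.trans trans (subst (v ≼_) (trans xy≡xz xz≡vz) (lcp-greatest v≼px v≼py)) (lcp-≼ʳ v pz))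
    where xz≡vz = lcp-outside pz v≼px v⋠pz

  module _ (t : Tree n M) {x y z px py pz}
           (ex : pos t x ≡ just px) (ey : pos t y ≡ just py) (ez : pos t z ≡ just pz) where

    Displays⇒lcp : Displays t x y z → lcp′ px pz ≡ lcp′ py pz × lcp′ px py ≢ lcp′ px pz
    Displays⇒lcp (_ , _ , _ , xz≡yz , xy≢xz) rewrite ex | ey | ez = just-injective xz≡yz , xy≢xz ∘ cong just

    lcp⇒Displays : lcp′ px pz ≡ lcp′ py pz → lcp′ px py ≢ lcp′ px pz → Displays t x y z
    lcp⇒Displays xz≡yz xy≢xz rewrite ex | ey | ez =
      Maybe.just tt , Maybe.just tt , Maybe.just tt , cong just xz≡yz , xy≢xz ∘ just-injective

  Separates : Tree n M → Fin n → Fin n → Fin n → Set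
  Separates t x y z = ∃[ s ] s ⊑ t × x ∈ leaves s × y ∈ leaves s × z ∉ leaves s

  displays⇒separates : ∀ (t : Tree n M) {x y z} → Unique (leaves t) → Displays t x y z → Separates t x y z
  displays⇒separates t {x} {y} {z} u disp@(jx , jy , jz , _)
    with Is-just⇒just jx | Is-just⇒just jy | Is-just⇒just jz
  ... | px , ex | py , ey | pz , ez with Displays⇒lcp t ex ey ez disp
  ...   | xz≡yz , xy≢xz
    with pos-below t (lcp′ px py) ex (lcp-≼ˡ px py) | pos-below t (lcp′ px py) ey (lcp-≼ʳ px py)
  ...     | s , es , x∈s | s′ , es′ , y∈s′ with trans (sym es) es′
  ...       | refl = s , subtreeAt⇒⊑ t (lcp′ px py) es , x∈s , y∈s′ , z∉s
    where
      z∉s : z ∉ leaves s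
      z∉s z∈s with pos-under t (lcp′ px py) u es z∈s
      ... | pz′ , ez′ , xy≼pz′ with trans (sym ez) ez′
      ...   | refl = xy≢xz (lcp-converge px py pz xz≡yz xy≼pz′)

  separates⇒displays : ∀ (t : Tree n M) {x y z} → Unique (leaves t) → z ∈ leaves t → Separates t x y z →
                       Displays t x y z
  separates⇒displays t {x} {y} {z} u z∈t (s , s⊑t , x∈s , y∈s , z∉s) with ⊑⇒subtreeAt s⊑t
  ... | v , es with pos-under t v u es x∈s | pos-under t v u es y∈s | pos-complete t z∈t
  ...   | px , ex , v≼px | py , ey , v≼py | pz , ez =
    uncurry (lcp⇒Displays t ex ey ez) (lcp-split pz v≼px v≼py v⋠pz)
    where
      v⋠pz : ¬ v ≼ pz
      v⋠pz v≼pz with pos-below t v ez v≼pz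
      ... | s′ , es′ , z∈s′ with trans (sym es) es′
      ...   | refl = z∉s z∈s′

  lca-just : ∀ (t : Tree n M) x y {p q} → pos t x ≡ just p → pos t y ≡ just q → lca t x y ≡ just (lcp′ p q)
  lca-just t x y ex ey rewrite ex | ey = refl

  lcp-≢ : ∀ {i j} p q → i ≢ j → lcp′ (i ∷ p) (j ∷ q) ≡ []
  lcp-≢ {i} {j} p q i≢j with i ≟ j
  ... | yes i≡j = ⊥-elim (i≢j i≡j)
  ... | no _ = refl

  lcaLabel-at : ∀ (t : Tree n M) x y {v} → lca t x y ≡ just v → lcaLabel t x y ≡ (subtreeAt t v >>=ᵐ rootLabel)
  lcaLabel-at t x y e rewrite e = refl

  lcaLabel-child : ∀ m {ts c x y} → c ∈ ts → Unique (leavesL ts) → x ∈ leaves c → y ∈ leaves c →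
                   lcaLabel (node m ts) x y ≡ lcaLabel c x y
  lcaLabel-child m {ts} {c} {x} {y} c∈ u x∈ y∈ with pos-complete c x∈ | pos-complete c y∈
  ... | p , ex | q , ey = begin
    lcaLabel (node m ts) x y
      ≡⟨ lcaLabel-at (node m ts) x y (lca-just (node m ts) x y (pos-node⁺ m c∈ u ex) (pos-node⁺ m c∈ u ey)) ⟩
    (subtreeAt (node m ts) (lcp′ (i ∷ p) (i ∷ q)) >>=ᵐ rootLabel)
      ≡⟨ cong (λ v → subtreeAt (node m ts) v >>=ᵐ rootLabel) (lcp-∷ i p q) ⟩
    (subtreeAt (node m ts) (i ∷ lcp′ p q) >>=ᵐ rootLabel)
      ≡⟨ cong (_>>=ᵐ rootLabel) (subtreeAt-child m c∈ (lcp′ p q)) ⟩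
    (subtreeAt c (lcp′ p q) >>=ᵐ rootLabel)
      ≡⟨ sym (lcaLabel-at c x y (lca-just c x y ex ey)) ⟩
    lcaLabel c x y ∎
    where
      open ≡-Reasoning
      i = childIndex c∈

  lcaLabel-root : ∀ m ts {x y} → (∀ {c} → c ∈ ts → x ∈ leaves c → y ∉ leaves c) →
                  x ∈ leavesL ts → y ∈ leavesL ts → lcaLabel (node m ts) x y ≡ just m
  lcaLabel-root m ts {x} {y} apart x∈ y∈ with pos-complete (node m ts) x∈ | pos-complete (node m ts) y∈
  ... | px , ex | py , ey with pos-node⁻ m ts ex | pos-node⁻ m ts ey
  ...   | c , c∈ , p , refl , ec | d , d∈ , q , refl , ed =
    trans (lcaLabel-at (node m ts) x y (lca-just (node m ts) x y ex ey))
          (cong (λ v → subtreeAt (node m ts) v >>=ᵐ rootLabel) (lcp-≢ p q i≢j))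
    where
      i≢j : childIndex c∈ ≢ childIndex d∈
      i≢j e with childIndex-injective c∈ d∈ e
      ... | refl = apart c∈ (pos-sound c ec) (pos-sound c ed)

module LcaLabel {n : ℕ} {M : Set} (a b : Fin n) where

  open import Data.List.Membership.DecPropositional (_≟ᶠ_ {n}) using (_∈?_)
  open ≡-Reasoning

  Covers : List (Fin n) → Set
  Covers xs = a ∈ xs × b ∈ xs

  covers? : (xs : List (Fin n)) → Dec (Covers xs)
  covers? xs = a ∈? xs ×-dec b ∈? xs

  CoveredByChild : List (Tree n M) → Set
  CoveredByChild = Any (Covers ∘ leaves)

  mutual
    lcaLabelᵗ : Tree n M → Maybe M
    lcaLabelᵗ (leaf _) = nothing
    lcaLabelᵗ (node m ts) = lcaLabelᶠ m ts

    lcaLabelᶠ : M → List (Tree n M) → Maybe M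
    lcaLabelᶠ m [] = just m
    lcaLabelᶠ m (c ∷ cs) = if does (covers? (leaves c)) then lcaLabelᵗ c else lcaLabelᶠ m cs

  covered⇒Covers : ∀ {ts} → CoveredByChild ts → Covers (leavesL ts)
  covered⇒Covers cov with find cov
  ... | c , c∈ , a∈ , b∈ = leaves⊆leavesL c∈ a∈ , leaves⊆leavesL c∈ b∈

  lcaLabelᶠ-skip : ∀ m pre cs → ¬ CoveredByChild pre → lcaLabelᶠ m (pre ++ cs) ≡ lcaLabelᶠ m cs
  lcaLabelᶠ-skip m [] cs _ = refl
  lcaLabelᶠ-skip m (c ∷ pre) cs none
    rewrite dec-false (covers? (leaves c)) (none ∘ here) = lcaLabelᶠ-skip m pre cs (none ∘ there)

  lcaLabelᶠ-none : ∀ m cs → ¬ CoveredByChild cs → lcaLabelᶠ m cs ≡ just m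
  lcaLabelᶠ-none m cs none = trans (cong (lcaLabelᶠ m) (sym (++-identityʳ cs))) (lcaLabelᶠ-skip m cs [] none)

  lcaLabelᶠ-++ : ∀ m pre cs → a ∉ leavesL cs → lcaLabelᶠ m (pre ++ cs) ≡ lcaLabelᶠ m pre
  lcaLabelᶠ-++ m [] cs a∉ = lcaLabelᶠ-none m cs λ cov → a∉ (proj₁ (covered⇒Covers cov))
  lcaLabelᶠ-++ m (c ∷ pre) cs a∉ =
    cong (if does (covers? (leaves c)) then lcaLabelᵗ c else_) (lcaLabelᶠ-++ m pre cs a∉)

  lcaLabelᶠ-child : ∀ m {c ts} → c ∈ ts → Unique (leavesL ts) → Covers (leaves c) → lcaLabelᶠ m ts ≡ lcaLabelᵗ c
  lcaLabelᶠ-child m {c} c∈ u cov with ∈-∃++ c∈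
  ... | pre , post , refl with Unique-++⁻ (leavesL pre) (subst Unique (leavesL-++ pre (c ∷ post)) u)
  ...   | _ , _ , disj
    rewrite lcaLabelᶠ-skip m pre (c ∷ post) (λ cov′ → disj (proj₁ (covered⇒Covers cov′) , ∈-++⁺ˡ (proj₁ cov)))
          | dec-true (covers? (leaves c)) cov = refl

  lcaLabel≡lcaLabelᵗ : ∀ t → Unique (leaves t) → Covers (leaves t) → lcaLabel t a b ≡ lcaLabelᵗ t
  lcaLabel≡lcaLabelᵗ (leaf y) u (here refl , here refl) with y ≟ᶠ y
  ... | yes _ = refl
  ... | no y≢y = ⊥-elim (y≢y refl)
  lcaLabel≡lcaLabelᵗ (node m ts) u (a∈ , b∈) with Any.any? (covers? ∘ leaves) ts
  ... | yes cov with find cov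
  ...   | c , c∈ , a∈c , b∈c = begin
    lcaLabel (node m ts) a b  ≡⟨ lcaLabel-child m c∈ u a∈c b∈c ⟩
    lcaLabel c a b            ≡⟨ children ts c∈ (unique-child c∈ u) (a∈c , b∈c) ⟩
    lcaLabelᵗ c               ≡⟨ sym (lcaLabelᶠ-child m c∈ u (a∈c , b∈c)) ⟩
    lcaLabelᶠ m ts            ∎
    where
      children : ∀ ts {c} → c ∈ ts → Unique (leaves c) → Covers (leaves c) → lcaLabel c a b ≡ lcaLabelᵗ c
      children (t ∷ _) (here refl) = lcaLabel≡lcaLabelᵗ t
      children (_ ∷ ts) (there c∈) = children ts c∈
  lcaLabel≡lcaLabelᵗ (node m ts) u (a∈ , b∈) | no none =
    trans (lcaLabel-root m ts (λ c∈ a∈c b∈c → none (lose c∈ (a∈c , b∈c))) a∈ b∈) (sym (lcaLabelᶠ-none m ts none))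

module Restriction {n : ℕ} {M : Set} (Y : Subset n) where

  open ≡-Reasoning

  filterY : List (Fin n) → List (Fin n)
  filterY = filter (_∈ˢ? Y)

  suppress : M → List (Tree n M) → List (Tree n M)
  suppress m [] = []
  suppress m (c ∷ []) = c ∷ []
  suppress m cs@(_ ∷ _ ∷ _) = node m cs ∷ []

  -- the restriction to Y, encoded as a forest with at most one tree ([] when no leaf lies in Y)
  mutual
    restrict : Tree n M → List (Tree n M)
    restrict (leaf x) = if does (x ∈ˢ? Y) then leaf x ∷ [] else []
    restrict (node m ts) = suppress m (restrictL ts)

    restrictL : List (Tree n M) → List (Tree n M)
    restrictL [] = []
    restrictL (t ∷ ts) = restrict t ++ restrictL ts

  restrict-shape : ∀ t → restrict t ≡ [] ⊎ ∃ λ r → restrict t ≡ r ∷ []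
  restrict-shape (leaf x) with x ∈ˢ? Y
  ... | yes _ = inj₂ (leaf x , refl)
  ... | no _ = inj₁ refl
  restrict-shape (node m ts) with restrictL ts
  ... | [] = inj₁ refl
  ... | _ ∷ [] = inj₂ (_ , refl)
  ... | _ ∷ _ ∷ _ = inj₂ (_ , refl)

  suppress-leaves : ∀ m cs → leavesL (suppress m cs) ≡ leavesL cs
  suppress-leaves m [] = refl
  suppress-leaves m (c ∷ []) = refl
  suppress-leaves m (c ∷ d ∷ cs) = ++-identityʳ _

  mutual
    restrict-leaves : ∀ t → leavesL (restrict t) ≡ filterY (leaves t)
    restrict-leaves (leaf x) with x ∈ˢ? Y
    ... | yes _ = refl
    ... | no _ = refl
    restrict-leaves (node m ts) = trans (suppress-leaves m (restrictL ts)) (restrictL-leaves ts)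

    restrictL-leaves : ∀ ts → leavesL (restrictL ts) ≡ filterY (leavesL ts)
    restrictL-leaves [] = refl
    restrictL-leaves (t ∷ ts) = begin
      leavesL (restrict t ++ restrictL ts)                 ≡⟨ leavesL-++ (restrict t) (restrictL ts) ⟩
      leavesL (restrict t) ++ leavesL (restrictL ts)       ≡⟨ cong₂ _++_ (restrict-leaves t) (restrictL-leaves ts) ⟩
      filterY (leaves t) ++ filterY (leavesL ts)           ≡⟨ sym (filter-++ (_∈ˢ? Y) (leaves t) (leavesL ts)) ⟩
      filterY (leaves t ++ leavesL ts)                     ∎

  restrict-leaves-single : ∀ t {r} → restrict t ≡ r ∷ [] → leaves r ≡ filterY (leaves t)
  restrict-leaves-single t {r} e =
    trans (sym (++-identityʳ (leaves r))) (trans (cong leavesL (sym e)) (restrict-leaves t))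

  restrict-empty : ∀ t {x} → restrict t ≡ [] → x ∈ leaves t → x ∉ˢ Y
  restrict-empty t e x∈t x∈Y
    with subst (_ ∈_) (trans (sym (restrict-leaves t)) (cong leavesL e)) (∈-filter⁺ (_∈ˢ? Y) x∈t x∈Y)
  ... | ()

  suppress-NoUnary : ∀ m {cs} → All NoUnary cs → All NoUnary (suppress m cs)
  suppress-NoUnary m [] = []
  suppress-NoUnary m (nu ∷ []) = nu ∷ []
  suppress-NoUnary m nus@(_ ∷ _ ∷ _) = nodeN m _ (s≤s (s≤s z≤n)) (All⇒AllNoUnary nus) ∷ []

  mutual
    restrict-NoUnary : ∀ t → All NoUnary (restrict t)
    restrict-NoUnary (leaf x) with x ∈ˢ? Y
    ... | yes _ = leafN x ∷ []
    ... | no _ = []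
    restrict-NoUnary (node m ts) = suppress-NoUnary m (restrictL-NoUnary ts)

    restrictL-NoUnary : ∀ ts → All NoUnary (restrictL ts)
    restrictL-NoUnary [] = []
    restrictL-NoUnary (t ∷ ts) = AllP.++⁺ (restrict-NoUnary t) (restrictL-NoUnary ts)

  suppress-⊑ : ∀ m cs {s} → Any (s ⊑_) (suppress m cs) → Any (s ⊑_) cs ⊎ s ≡ node m cs
  suppress-⊑ m (c ∷ []) s⊑ = inj₁ s⊑
  suppress-⊑ m (c ∷ d ∷ cs) (here here) = inj₂ refl
  suppress-⊑ m (c ∷ d ∷ cs) (here (child c∈ s⊑c)) = inj₁ (lose c∈ s⊑c)

  mutual
    restrict-⊑ : ∀ t {s} → Any (s ⊑_) (restrict t) → ∃ λ s₀ → s₀ ⊑ t × leaves s ≡ filterY (leaves s₀)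
    restrict-⊑ (leaf x) s⊑ with x ∈ˢ? Y
    restrict-⊑ (leaf x) (here here) | yes x∈Y = leaf x , here , sym (filter-accept (_∈ˢ? Y) x∈Y)
    restrict-⊑ (node m ts) s⊑ with suppress-⊑ m (restrictL ts) s⊑
    ... | inj₂ refl = node m ts , here , restrictL-leaves ts
    ... | inj₁ s⊑′ with restrictL-⊑ ts s⊑′
    ...   | s₀ , s₀⊑ , e = s₀ , ⊑-child s₀⊑ , e

    restrictL-⊑ : ∀ ts {s} → Any (s ⊑_) (restrictL ts) → ∃ λ s₀ → Any (s₀ ⊑_) ts × leaves s ≡ filterY (leaves s₀)
    restrictL-⊑ (t ∷ ts) s⊑ with AnyP.++⁻ (restrict t) s⊑
    ... | inj₁ s⊑t = Product.map₂ (Product.map₁ here) (restrict-⊑ t s⊑t)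
    ... | inj₂ s⊑ts = Product.map₂ (Product.map₁ there) (restrictL-⊑ ts s⊑ts)

  module _ {a b : Fin n} (a∈Y : a ∈ˢ Y) (b∈Y : b ∈ˢ Y) where
    open LcaLabel {n} {M} a b

    restrict-Covers⁺ : ∀ t {r} → restrict t ≡ r ∷ [] → Covers (leaves t) → Covers (leaves r)
    restrict-Covers⁺ t e (a∈ , b∈) rewrite restrict-leaves-single t e =
      ∈-filter⁺ (_∈ˢ? Y) a∈ a∈Y , ∈-filter⁺ (_∈ˢ? Y) b∈ b∈Y

    restrict-Covers⁻ : ∀ t {r} → restrict t ≡ r ∷ [] → Covers (leaves r) → Covers (leaves t)
    restrict-Covers⁻ t e (a∈ , b∈) rewrite restrict-leaves-single t e =
      proj₁ (∈-filter⁻ (_∈ˢ? Y) a∈) , proj₁ (∈-filter⁻ (_∈ˢ? Y) b∈)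

    suppress-lcaLabel : ∀ m cs {r} → suppress m cs ≡ r ∷ [] → Covers (leavesL cs) → lcaLabelᵗ r ≡ lcaLabelᶠ m cs
    suppress-lcaLabel m (c ∷ []) refl cov
      rewrite dec-true (covers? (leaves c)) (subst Covers (++-identityʳ (leaves c)) cov) = refl
    suppress-lcaLabel m (c ∷ d ∷ cs) refl cov = refl

    mutual
      restrict-lcaLabel : ∀ t {r} → restrict t ≡ r ∷ [] → Covers (leaves t) → lcaLabelᵗ r ≡ lcaLabelᵗ t
      restrict-lcaLabel (leaf x) e _ with x ∈ˢ? Y
      restrict-lcaLabel (leaf x) refl _ | yes _ = refl
      restrict-lcaLabel (node m ts) e (a∈ , b∈) =
        trans (suppress-lcaLabel m (restrictL ts) e (in-restrictL a∈ a∈Y , in-restrictL b∈ b∈Y))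
              (restrictL-lcaLabel m ts)
        where
          in-restrictL : ∀ {x} → x ∈ leavesL ts → x ∈ˢ Y → x ∈ leavesL (restrictL ts)
          in-restrictL x∈ x∈Y = subst (_ ∈_) (sym (restrictL-leaves ts)) (∈-filter⁺ (_∈ˢ? Y) x∈ x∈Y)

      restrictL-lcaLabel : ∀ m ts → lcaLabelᶠ m (restrictL ts) ≡ lcaLabelᶠ m ts
      restrictL-lcaLabel m [] = refl
      restrictL-lcaLabel m (t ∷ ts) with restrict-shape t
      ... | inj₁ e rewrite e
                         | dec-false (covers? (leaves t)) (λ (a∈ , _) → restrict-empty t e a∈ a∈Y) =
        restrictL-lcaLabel m ts
      ... | inj₂ (r , e) rewrite e with covers? (leaves t)
      ...   | yes cov rewrite dec-true (covers? (leaves r)) (restrict-Covers⁺ t e cov)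
                            | dec-true (covers? (leaves t)) cov = restrict-lcaLabel t e cov
      ...   | no ¬cov rewrite dec-false (covers? (leaves r)) (¬cov ∘ restrict-Covers⁻ t e)
                            | dec-false (covers? (leaves t)) ¬cov = restrictL-lcaLabel m ts

module Contraction {n : ℕ} {M : Set} where

  open RawMonad (¬¬-Monad {a = 0ℓ}) using (pure; _>>=_)
  open ≡-Reasoning

  -- Contract t t′: t′ arises from t by contracting, bottom-up, every edge whose ends carry the same label.
  mutual
    data Contract : Tree n M → Tree n M → Set where
      leaf : ∀ x → Contract (leaf x) (leaf x)
      node : ∀ {m ts fs} → ContractChildren m ts fs → Contract (node m ts) (node m fs)

    data ContractChildren (m : M) : List (Tree n M) → List (Tree n M) → Set where
      []    : ContractChildren m [] []
      keep  : ∀ {c c′ cs fs} → Contract c c′ → rootLabel c′ ≢ just m →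
              ContractChildren m cs fs → ContractChildren m (c ∷ cs) (c′ ∷ fs)
      merge : ∀ {c ds cs fs} → Contract c (node m ds) →
              ContractChildren m cs fs → ContractChildren m (c ∷ cs) (ds ++ fs)

  attach : ∀ {m c c′ cs fs} → Contract c c′ → ContractChildren m cs fs →
           Dec (rootLabel c′ ≡ just m) → ∃ (ContractChildren m (c ∷ cs))
  attach {c′ = leaf _} _ _ (yes ())
  attach {c′ = node _ _} cc ccs (yes refl) = -, merge cc ccs
  attach cc ccs (no c′≢m) = -, keep cc c′≢m ccs

  mutual
    contract : ∀ t → ¬ ¬ ∃ (Contract t)
    contract (leaf x) = pure (leaf x , leaf x)
    contract (node m ts) = do
      fs , ccs ← contractChildren m ts
      pure (node m fs , node ccs)

    contractChildren : ∀ m ts → ¬ ¬ ∃ (ContractChildren m ts)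
    contractChildren m [] = pure ([] , [])
    contractChildren m (c ∷ cs) = do
      c′ , cc ← contract c
      fs , ccs ← contractChildren m cs
      c′≟m ← ¬¬-excluded-middle
      pure (attach cc ccs c′≟m)

  mutual
    contract-leaves : ∀ {t t′} → Contract t t′ → leaves t′ ≡ leaves t
    contract-leaves (leaf x) = refl
    contract-leaves (node ccs) = contractChildren-leaves ccs

    contractChildren-leaves : ∀ {m ts fs} → ContractChildren m ts fs → leavesL fs ≡ leavesL ts
    contractChildren-leaves [] = refl
    contractChildren-leaves (keep cc _ ccs) = cong₂ _++_ (contract-leaves cc) (contractChildren-leaves ccs)
    contractChildren-leaves (merge {ds = ds} {fs = fs} cc ccs) =
      trans (leavesL-++ ds fs) (cong₂ _++_ (contract-leaves cc) (contractChildren-leaves ccs))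

  mutual
    contract-Discriminating : ∀ {t t′} → Contract t t′ → Discriminating t′
    contract-Discriminating (leaf x) = leafD x
    contract-Discriminating (node {m} {fs = fs} ccs) = nodeD m fs (contractChildren-ChildrenD ccs)

    contractChildren-ChildrenD : ∀ {m ts fs} → ContractChildren m ts fs → ChildrenD m fs
    contractChildren-ChildrenD [] = []
    contractChildren-ChildrenD (keep cc c′≢m ccs) =
      (c′≢m , contract-Discriminating cc) ∷ contractChildren-ChildrenD ccs
    contractChildren-ChildrenD (merge cc ccs) with contract-Discriminating cc
    ... | nodeD _ _ cds = ChildrenD-++ cds (contractChildren-ChildrenD ccs)

  mutual
    contract-NoUnary : ∀ {t t′} → Contract t t′ → NoUnary t → NoUnary t′
    contract-NoUnary (leaf x) nu = nu
    contract-NoUnary (node {m} {fs = fs} ccs) (nodeN _ _ 2≤ts nus)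
      with contractChildren-NoUnary ccs (AllNoUnary⇒All nus)
    ... | nufs , ts≤fs = nodeN m fs (≤-trans 2≤ts ts≤fs) (All⇒AllNoUnary nufs)

    contractChildren-NoUnary : ∀ {m ts fs} → ContractChildren m ts fs → All NoUnary ts →
                               All NoUnary fs × length ts ≤ length fs
    contractChildren-NoUnary [] [] = [] , z≤n
    contractChildren-NoUnary (keep cc _ ccs) (nu ∷ nus) =
      Product.map (contract-NoUnary cc nu ∷_) s≤s (contractChildren-NoUnary ccs nus)
    contractChildren-NoUnary (merge {cs = cs} {fs} cc ccs) (nu ∷ nus)
      with contract-NoUnary cc nu | contractChildren-NoUnary ccs nus
    ... | nodeN _ (d ∷ ds) _ nuds | nufs , cs≤fs =
      AllP.++⁺ (AllNoUnary⇒All nuds) nufs ,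
      s≤s (≤-trans cs≤fs (subst (length fs ≤_) (sym (length-++ ds)) (m≤n+m (length fs) (length ds))))

  mutual
    contract-⊑ : ∀ {t t′ s} → Contract t t′ → s ⊑ t′ → ∃ λ s₀ → s₀ ⊑ t × leaves s ≡ leaves s₀
    contract-⊑ cc here = _ , here , contract-leaves cc
    contract-⊑ (node ccs) (child f∈ s⊑f) =
      Product.map₂ (Product.map₁ ⊑-child) (contractChildren-⊑ ccs (lose f∈ s⊑f))

    contractChildren-⊑ : ∀ {m ts fs s} → ContractChildren m ts fs → Any (s ⊑_) fs →
                         ∃ λ s₀ → Any (s₀ ⊑_) ts × leaves s ≡ leaves s₀
    contractChildren-⊑ (keep cc _ ccs) (here s⊑c′) = Product.map₂ (Product.map₁ here) (contract-⊑ cc s⊑c′)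
    contractChildren-⊑ (keep cc _ ccs) (there s⊑) = Product.map₂ (Product.map₁ there) (contractChildren-⊑ ccs s⊑)
    contractChildren-⊑ (merge {ds = ds} cc ccs) s⊑ with AnyP.++⁻ ds s⊑
    ... | inj₁ s⊑ds = Product.map₂ (Product.map₁ here) (contract-⊑ cc (⊑-child s⊑ds))
    ... | inj₂ s⊑fs = Product.map₂ (Product.map₁ there) (contractChildren-⊑ ccs s⊑fs)

  module _ (a b : Fin n) where
    open LcaLabel {n} {M} a b

    mutual
      contract-lcaLabel : ∀ {t t′} → Contract t t′ → Unique (leaves t) → lcaLabelᵗ t′ ≡ lcaLabelᵗ t
      contract-lcaLabel (leaf x) _ = refl
      contract-lcaLabel (node ccs) u = contractChildren-lcaLabel ccs u

      contractChildren-lcaLabel : ∀ {m ts fs} → ContractChildren m ts fs → Unique (leavesL ts) →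
                                  lcaLabelᶠ m fs ≡ lcaLabelᶠ m ts
      contractChildren-lcaLabel [] _ = refl
      contractChildren-lcaLabel (keep {c} cc _ ccs) u with Unique-++⁻ (leaves c) u
      ... | uc , ucs , _
        rewrite contract-leaves cc | contract-lcaLabel cc uc | contractChildren-lcaLabel ccs ucs = refl
      contractChildren-lcaLabel {m} (merge {c} {ds} {cs} {fs} cc ccs) u with Unique-++⁻ (leaves c) u
      ... | uc , ucs , disj with covers? (leaves c)
      ...   | yes cov rewrite dec-true (covers? (leaves c)) cov = begin
        lcaLabelᶠ m (ds ++ fs)  ≡⟨ lcaLabelᶠ-++ m ds fs a∉fs ⟩
        lcaLabelᶠ m ds          ≡⟨ contract-lcaLabel cc uc ⟩
        lcaLabelᵗ c             ∎
        where
          a∉fs : a ∉ leavesL fs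
          a∉fs a∈fs = disj (proj₁ cov , subst (a ∈_) (contractChildren-leaves ccs) a∈fs)
      ...   | no ¬cov rewrite dec-false (covers? (leaves c)) ¬cov = begin
        lcaLabelᶠ m (ds ++ fs)  ≡⟨ lcaLabelᶠ-skip m ds fs
                                      (¬cov ∘ subst Covers (contract-leaves cc) ∘ covered⇒Covers) ⟩
        lcaLabelᶠ m fs          ≡⟨ contractChildren-lcaLabel ccs ucs ⟩
        lcaLabelᶠ m cs          ∎

module _ {n : ℕ} {M : Set} where

  mutual
    ≅⇒leaves-↭ : {t u : Tree n M} → t ≅ u → leaves t ↭ leaves u
    ≅⇒leaves-↭ (leaf≅ x) = ↭-refl
    ≅⇒leaves-↭ (node≅ m ts≅us) = ≅L⇒leaves-↭ ts≅us

    ≅L⇒leaves-↭ : {ts us : List (Tree n M)} → ts ≅L us → leavesL ts ↭ leavesL us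
    ≅L⇒leaves-↭ [] = ↭-refl
    ≅L⇒leaves-↭ (cons {t} {s} {ts} as bs t≅s ts≅) = begin
      leaves t ++ leavesL ts                 ↭⟨ ↭.++⁺ (≅⇒leaves-↭ t≅s) (≅L⇒leaves-↭ ts≅) ⟩
      leaves s ++ leavesL (as ++ bs)         ≡⟨ cong (leaves s ++_) (leavesL-++ as bs) ⟩
      leaves s ++ leavesL as ++ leavesL bs   ↭⟨ ↭.shifts (leaves s) (leavesL as) ⟩
      leavesL as ++ leaves s ++ leavesL bs   ≡⟨ sym (leavesL-++ as (s ∷ bs)) ⟩
      leavesL (as ++ s ∷ bs)                 ∎
      where open PermutationReasoning

  ≅L-∈ : ∀ {ts us : List (Tree n M)} {c} → ts ≅L us → c ∈ us → ∃ λ c′ → c′ ∈ ts × c′ ≅ c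
  ≅L-∈ (cons as bs t≅s ts≅) c∈ with ∈-++⁻ as c∈
  ... | inj₂ (here refl) = _ , here refl , t≅s
  ... | inj₁ c∈as = Product.map₂ (Product.map₁ there) (≅L-∈ ts≅ (∈-++⁺ˡ c∈as))
  ... | inj₂ (there c∈bs) = Product.map₂ (Product.map₁ there) (≅L-∈ ts≅ (∈-++⁺ʳ as c∈bs))

  ≅-⊑ : ∀ {t u s : Tree n M} → t ≅ u → s ⊑ u → ∃ λ s′ → s′ ⊑ t × s′ ≅ s
  ≅-⊑ t≅u here = _ , here , t≅u
  ≅-⊑ (node≅ m ts≅us) (child c∈ s⊑c) with ≅L-∈ ts≅us c∈
  ... | c′ , c′∈ , c′≅c = Product.map₂ (Product.map₁ (child c′∈)) (≅-⊑ c′≅c s⊑c)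

  Separates-≅ : ∀ {t u : Tree n M} {x y z} → t ≅ u → Separates u x y z → Separates t x y z
  Separates-≅ t≅u (s , s⊑u , x∈s , y∈s , z∉s) with ≅-⊑ t≅u s⊑u
  ... | s′ , s′⊑t , s′≅s = s′ , s′⊑t , back x∈s , back y∈s , z∉s ∘ ∈-resp-↭ (≅⇒leaves-↭ s′≅s)
    where
      back : ∀ {w} → w ∈ leaves s → w ∈ leaves s′
      back = ∈-resp-↭ (↭-sym (≅⇒leaves-↭ s′≅s))

  displays? : ∀ (t : Tree n M) x y z → Dec (Displays t x y z)
  displays? t x y z =
    just? (pos t x) ×-dec just? (pos t y) ×-dec just? (pos t z) ×-dec
    lca t x z ≟ₐ lca t y z ×-dec ¬? (lca t x y ≟ₐ lca t x z)
    where
      just? : (m : Maybe (List ℕ)) → Dec (Is-just m)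
      just? = Maybe.dec (λ _ → yes tt)
      _≟ₐ_ = ≡-dec (ListP.≡-dec _≟_)

  Is-just-pos⇒∈ : ∀ (t : Tree n M) {x} → Is-just (pos t x) → x ∈ leaves t
  Is-just-pos⇒∈ t j = pos-sound t (proj₂ (Is-just⇒just j))

module _ {n : ℕ} {M : Set} (T : Tree n M) (Y : Subset n) (phT : IsPhyloOn ⊤ T) where

  open Restriction {n} {M} Y
  open Contraction {n} {M}
  open IsPhyloOn phT renaming (leavesUnique to uniqueT)

  private
    leafT : ∀ x → x ∈ leaves T
    leafT x = proj₁ (leafSet x) ∈⊤

  ClustersRestrict : Tree n M → Set
  ClustersRestrict r = ∀ {s} → s ⊑ r → ∃ λ s₀ → s₀ ⊑ T × leaves s ≡ filterY (leaves s₀)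

  ClustersRestrict⇒Separates : ∀ {r x y z} → ClustersRestrict r → z ∈ˢ Y → Separates r x y z → Separates T x y z
  ClustersRestrict⇒Separates clusters z∈Y (s , s⊑r , x∈s , y∈s , z∉s) with clusters s⊑r
  ... | s₀ , s₀⊑T , e = s₀ , s₀⊑T , unfilter x∈s , unfilter y∈s ,
                         λ z∈s₀ → z∉s (subst (_ ∈_) (sym e) (∈-filter⁺ (_∈ˢ? Y) z∈s₀ z∈Y))
    where
      unfilter : ∀ {w} → w ∈ leaves s → w ∈ leaves s₀
      unfilter w∈s = proj₁ (∈-filter⁻ (_∈ˢ? Y) (subst (_ ∈_) e w∈s))

  DiscriminatingRestriction : Tree n M → Set
  DiscriminatingRestriction r = IsPhyloOn Y r × Discriminating r × Represents Y r T × ClustersRestrict r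

  module _ {r r′} (e : restrict T ≡ r ∷ []) (cc : Contract r r′) where

    private
      leaves-r′ : leaves r′ ≡ filterY (leaves T)
      leaves-r′ = trans (contract-leaves cc) (restrict-leaves-single T e)

      unique-r′ : Unique (leaves r′)
      unique-r′ = subst Unique (sym leaves-r′) (UniqueP.filter⁺ (_∈ˢ? Y) uniqueT)

      ∈-r′ : ∀ {x} → x ∈ˢ Y → x ∈ leaves r′
      ∈-r′ x∈Y = subst (_ ∈_) (sym leaves-r′) (∈-filter⁺ (_∈ˢ? Y) (leafT _) x∈Y)

    contracted-IsPhyloOn : IsPhyloOn Y r′
    contracted-IsPhyloOn = record
      { noUnary = contract-NoUnary cc (All.head (subst (All NoUnary) e (restrict-NoUnary T)))
      ; leavesUnique = unique-r′
      ; leafSet = λ x → ∈-r′ , λ x∈ → proj₂ (∈-filter⁻ (_∈ˢ? Y) {xs = leaves T} (subst (_ ∈_) leaves-r′ x∈))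
      }

    contracted-lcaLabel : ∀ {p q} → p ∈ˢ Y → q ∈ˢ Y → lcaLabel r′ p q ≡ lcaLabel T p q
    contracted-lcaLabel {p} {q} p∈Y q∈Y = begin
      lcaLabel r′ p q  ≡⟨ lcaLabel≡lcaLabelᵗ r′ unique-r′ (∈-r′ p∈Y , ∈-r′ q∈Y) ⟩
      lcaLabelᵗ r′     ≡⟨ contract-lcaLabel p q cc (subst Unique (contract-leaves cc) unique-r′) ⟩
      lcaLabelᵗ r      ≡⟨ restrict-lcaLabel p∈Y q∈Y T e (leafT p , leafT q) ⟩
      lcaLabelᵗ T      ≡⟨ sym (lcaLabel≡lcaLabelᵗ T uniqueT (leafT p , leafT q)) ⟩
      lcaLabel T p q   ∎
      where
        open LcaLabel {n} {M} p q
        open ≡-Reasoning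

    contracted-Represents : Represents Y r′ T
    contracted-Represents p q s p∈Y q∈Y s∈Y _ = ↭-reflexive (cong₂ _∷_ (contracted-lcaLabel p∈Y q∈Y)
      (cong₂ _∷_ (contracted-lcaLabel p∈Y s∈Y) (cong₂ _∷_ (contracted-lcaLabel q∈Y s∈Y) refl)))

    contracted-ClustersRestrict : ClustersRestrict r′
    contracted-ClustersRestrict s⊑r′ with contract-⊑ cc s⊑r′
    ... | s₁ , s₁⊑r , e₁ with restrict-⊑ T (subst (Any (s₁ ⊑_)) (sym e) (here s₁⊑r))
    ...   | s₀ , s₀⊑T , e₀ = s₀ , s₀⊑T , trans e₁ e₀

    contracted-DiscriminatingRestriction : DiscriminatingRestriction r′
    contracted-DiscriminatingRestriction =
      contracted-IsPhyloOn , contract-Discriminating cc , contracted-Represents , contracted-ClustersRestrict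

  discriminatingRestriction : ∀ {w} → w ∈ˢ Y → ¬ ¬ ∃ DiscriminatingRestriction
  discriminatingRestriction {w} w∈Y with restrict-shape T
  ... | inj₁ e = ⊥-elim (restrict-empty T e (leafT w) w∈Y)
  ... | inj₂ (r , e) = ¬¬-map (λ (r′ , cc) → r′ , contracted-DiscriminatingRestriction e cc) (contract r)

lemma15 : {n : ℕ} {M : Set} (T : Tree n M) (Y : Subset n) (TY : Tree n M) →
          IsPhyloOn ⊤ T → Discriminating T → 4 ≤ ∣ Y ∣ →
          IsPhyloOn Y TY → Discriminating TY → Represents Y TY T →
          ((T' : Tree n M) → IsPhyloOn Y T' → Discriminating T' → Represents Y T' T → T' ≅ TY) →
          (x y z : Fin n) → Distinct3 {n} {M} x y z → Displays TY x y z → Displays T x y z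
lemma15 T Y TY phT _ _ phY _ _ unique x y z _ dispY@(jx , _ , jz , _) =
  decidable-stable (displays? T x y z) (¬¬-map conclude (discriminatingRestriction T Y phT (inY jx)))
  where
    inY : ∀ {w} → Is-just (pos TY w) → w ∈ˢ Y
    inY j = proj₂ (IsPhyloOn.leafSet phY _) (Is-just-pos⇒∈ TY j)

    conclude : ∃ (DiscriminatingRestriction T Y phT) → Displays T x y z
    conclude (r , phr , dr , repr , clusters) =
      separates⇒displays T (IsPhyloOn.leavesUnique phT) (proj₁ (IsPhyloOn.leafSet phT z) ∈⊤)
        (ClustersRestrict⇒Separates T Y phT clusters (inY jz)
          (Separates-≅ (unique r phr dr repr) (displays⇒separates TY (IsPhyloOn.leavesUnique phY) dispY)))
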